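{- Let $G$ be a minimal counterexample (as defined in the context), so $\Delta=\Delta(G)=7$. Let $w\in V(G)$ be adjacent to $k\geq 1$ distinct vertices $u_1,\dots,u_k$ (with $k\leq d(w)$) such that $d^*(u_i)\leq \Delta+i-1$ for each $1\leq i\leq k$. Then $d^*(w)\geq \Delta+k+1$.
   Context: A $2$-distance $k$-coloring of a graph assigns colors from $\{1,\dots,k\}$ so that distinct vertices at distance at most $2$ get different colors. A minimal counterexample is a finite simple graph $G$ with $\mathrm{mad}(G)\leq 18/7$ (equivalently $9|A|-7|E(G[A])|\geq 0$ for all $A\subseteq V(G)$), maximum degree $\Delta(G)=7$, that has no $2$-distance $8$-coloring, and such that every graph $H$ with $\mathrm{mad}(H)\leq 18/7$, maximum degree at most $7$ and $|V(H)|+|E(H)|<|V(G)|+|E(G)|$ has a $2$-distance $8$-coloring. For a vertex $v$, $d(v)$ is its degree and $d^*(v)$ is the number of vertices other than $v$ at distance at most $2$ from $v$. -}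

module Defs where

open import Data.Nat using (ℕ; zero; suc; _+_; _*_; _≤_; _<_; _<ᵇ_)
open import Data.Bool using (Bool; true; false; _∧_; _∨_; not)
open import Data.Fin using (Fin; toℕ; _≟_)
open import Data.List using (List; []; _∷_; allFin)
open import Data.Bool.ListAction using (any)
open import Data.Vec using (Vec; lookup)
open import Data.Product using (Σ; _×_; _,_)
open import Relation.Nullary using (¬_)
open import Relation.Nullary.Decidable using (⌊_⌋)
open import Relation.Binary.PropositionalEquality using (_≡_; _≢_)

count : {A : Set} → (A → Bool) → List A → ℕ
count p [] = 0
count p (x ∷ xs) with p x
... | true  = suc (count p xs)
... | false = count p xs

record Graph : Set where
  field
    n      : ℕ
    adj    : Fin n → Fin n → Bool
    sym    : ∀ u v → adj u v ≡ adj v u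
    irrefl : ∀ v → adj v v ≡ false
open Graph public

V : (G : Graph) → List (Fin (n G))
V G = allFin (n G)

deg : (G : Graph) → Fin (n G) → ℕ
deg G v = count (adj G v) (V G)

MaxDeg≡ : Graph → ℕ → Set
MaxDeg≡ G D = (∀ v → deg G v ≤ D) × Σ (Fin (n G)) (λ v → deg G v ≡ D)

MaxDeg≤ : Graph → ℕ → Set
MaxDeg≤ G D = ∀ v → deg G v ≤ D

near : (G : Graph) → Fin (n G) → Fin (n G) → Bool
near G v u = not ⌊ v ≟ u ⌋ ∧
  (adj G v u ∨ any (λ x → adj G v x ∧ adj G x u) (V G))

dstar : (G : Graph) → Fin (n G) → ℕ
dstar G v = count (near G v) (V G)

Subset : ℕ → Set
Subset m = Vec Bool m

card : (G : Graph) → Subset (n G) → ℕ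
card G A = count (λ v → lookup A v) (V G)

sumL : {A : Set} → (A → ℕ) → List A → ℕ
sumL f [] = 0
sumL f (x ∷ xs) = f x + sumL f xs

eIn : (G : Graph) → Subset (n G) → ℕ
eIn G A = sumL (λ u → count (λ v →
    (toℕ u <ᵇ toℕ v) ∧ lookup A u ∧ lookup A v ∧ adj G u v) (V G)) (V G)

edges : Graph → ℕ
edges G = sumL (λ u → count (λ v → (toℕ u <ᵇ toℕ v) ∧ adj G u v) (V G)) (V G)

-- mad(G) ≤ 18/7, i.e. 9|A| - 7|E(G[A])| ≥ 0 for all A ⊆ V(G)
MadLe18/7 : Graph → Set
MadLe18/7 G = ∀ (A : Subset (n G)) → 7 * eIn G A ≤ 9 * card G A

TwoDistColoring : (G : Graph) → ℕ → Set
TwoDistColoring G k = Σ (Fin (n G) → Fin k) λ c →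
  ∀ u v → near G u v ≡ true → c u ≢ c v

MinimalCounterexample : Graph → Set
MinimalCounterexample G =
  MadLe18/7 G × MaxDeg≡ G 7 × ¬ TwoDistColoring G 8 ×
  (∀ (H : Graph) → MadLe18/7 H → MaxDeg≤ H 7 →
     n H + edges H < n G + edges G → TwoDistColoring H 8)

-- Delete the edge w u₁. By minimality G − w u₁ has a 2-distance 8-colouring, and it
-- is proper on G away from w and the uᵢ. Uncolour w, u_k, …, u₁ and recolour them
-- greedily in this order: if d*(w) ≤ Δ + k, then w sees at most Δ coloured vertices
-- since all k of the uᵢ are uncoloured, and uᵢ sees at most Δ coloured vertices since
-- u₁, …, u_{i-1} are still uncoloured and at distance 2 from uᵢ through w. So G
-- would be 8-colourable.
module Submission where

open import Defs
open import Data.Nat using (ℕ; _+_; _≤_; _≥_)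
open import Data.Fin using (Fin; toℕ)
open import Data.Bool using (true)
open import Function.Definitions using (Injective)
open import Relation.Binary.PropositionalEquality using (_≡_)

open import Data.Nat using (zero; suc; _<_; _<ᵇ_; _≤?_; z≤n; s≤s)
open import Data.Nat.Properties
  using (≤-trans; n≮n; +-comm; +-mono-≤; +-mono-<-≤; +-mono-≤-<; +-monoʳ-<; +-monoˡ-≤; *-monoʳ-≤;
         +-cancelˡ-≤; +-suc; m≤n⇒m≤1+n; m<n⇒m<1+n; ≰⇒>; <⇒<ᵇ; <-cmp; module ≤-Reasoning)
  renaming (_≟_ to _≟ℕ_)
open import Data.Fin using (fromℕ; inject₁; lower₁; _≟_)
import Data.Fin as F
open import Data.Fin.Properties
  using (toℕ-fromℕ; toℕ-inject₁; toℕ-injective; inject₁-lower₁; fromℕ≢inject₁;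
         inject₁-injective; suc-injective; 0≢1+n; any?; ¬∀⟶∃¬)
open import Data.Bool using (Bool; false; _∧_; _∨_; not)
open import Data.Bool.Properties
  using (∧-comm; ∧-conicalˡ; ∧-identityʳ; ∧-zeroʳ; ∨-zeroʳ; T-≡)
  renaming (_≟_ to _≟𝔹_)
open import Data.Bool.ListAction using (any; or)
open import Data.List using (List; []; _∷_; allFin)
open import Data.List.Properties using (map-cong)
open import Data.List.Membership.Propositional using (_∈_; _∉_; lose)
open import Data.List.Membership.Propositional.Properties using (∈-allFin)
open import Data.List.Relation.Unary.Any using (here; there)
open import Data.List.Relation.Unary.Any.Properties using (any⁺)
open import Data.Vec using (lookup)
open import Data.Product using (∃; _×_; _,_; proj₁; proj₂)
open import Data.Empty using (⊥-elim)
open import Function using (_∘_; Equivalence)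
open import Relation.Nullary using (¬_; yes; no; contradiction)
open import Relation.Binary using (tri<; tri≈; tri>)
open import Relation.Nullary.Decidable using (⌊_⌋; _×-dec_; Dec; dec-true; dec-false; isYes≗does)
open import Relation.Unary using (Decidable)
open import Relation.Binary.PropositionalEquality using (refl; trans; cong; cong₂; subst; _≢_)
  renaming (sym to ≡-sym)
open Equivalence using (to; from)

⌊⌋-yes : ∀ {A : Set} (a? : Dec A) → A → ⌊ a? ⌋ ≡ true
⌊⌋-yes a? a = trans (isYes≗does a?) (dec-true a? a)

⌊⌋-no : ∀ {A : Set} (a? : Dec A) → ¬ A → ⌊ a? ⌋ ≡ false
⌊⌋-no a? ¬a = trans (isYes≗does a?) (dec-false a? ¬a)

∧-monoʳ : ∀ a {b c : Bool} → (b ≡ true → c ≡ true) → a ∧ b ≡ true → a ∧ c ≡ true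
∧-monoʳ true b⇒c = b⇒c

any-true : ∀ {A : Set} (p : A → Bool) {x xs} → x ∈ xs → p x ≡ true → any p xs ≡ true
any-true p x∈xs px = to T-≡ (any⁺ p (lose x∈xs (from T-≡ px)))

module _ {A : Set} where

  count-mono : ∀ {p q : A → Bool} → (∀ y → p y ≡ true → q y ≡ true) →
               ∀ xs → count p xs ≤ count q xs
  count-mono {p} {q} p⇒q [] = z≤n
  count-mono {p} {q} p⇒q (x ∷ xs) with p x in px | q x in qx
  ... | true  | true  = s≤s (count-mono p⇒q xs)
  ... | true  | false = contradiction (trans (≡-sym (p⇒q x px)) qx) λ ()
  ... | false | true  = m≤n⇒m≤1+n (count-mono p⇒q xs)
  ... | false | false = count-mono p⇒q xs

  count-mono-< : ∀ {p q : A → Bool} → (∀ y → p y ≡ true → q y ≡ true) →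
                 ∀ {y xs} → y ∈ xs → p y ≡ false → q y ≡ true → count p xs < count q xs
  count-mono-< {p} {q} p⇒q {xs = x ∷ xs} (here refl) py qy rewrite py | qy =
    s≤s (count-mono p⇒q xs)
  count-mono-< {p} {q} p⇒q {xs = x ∷ xs} (there y∈xs) py qy with p x in px | q x in qx
  ... | true  | true  = s≤s (count-mono-< p⇒q y∈xs py qy)
  ... | true  | false = contradiction (trans (≡-sym (p⇒q x px)) qx) λ ()
  ... | false | true  = m<n⇒m<1+n (count-mono-< p⇒q y∈xs py qy)
  ... | false | false = count-mono-< p⇒q y∈xs py qy

  count-positive : ∀ {q : A → Bool} {y xs} → y ∈ xs → q y ≡ true → 1 ≤ count q xs
  count-positive {q} (here refl) qy rewrite qy = s≤s z≤n
  count-positive {q} {xs = x ∷ _} (there y∈xs) qy with q x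
  ... | true  = s≤s z≤n
  ... | false = count-positive y∈xs qy

  count-split : ∀ (p q : A → Bool) xs →
    count p xs ≡ count (λ y → p y ∧ q y) xs + count (λ y → p y ∧ not (q y)) xs
  count-split p q [] = refl
  count-split p q (x ∷ xs) with p x | q x
  ... | true  | true  = cong suc (count-split p q xs)
  ... | true  | false = trans (cong suc (count-split p q xs)) (≡-sym (+-suc _ _))
  ... | false | _     = count-split p q xs

  sumL-mono : ∀ {f g : A → ℕ} → (∀ x → f x ≤ g x) → ∀ xs → sumL f xs ≤ sumL g xs
  sumL-mono f≤g [] = z≤n
  sumL-mono f≤g (x ∷ xs) = +-mono-≤ (f≤g x) (sumL-mono f≤g xs)

  sumL-mono-< : ∀ {f g : A → ℕ} → (∀ x → f x ≤ g x) →
                ∀ {y xs} → y ∈ xs → f y < g y → sumL f xs < sumL g xs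
  sumL-mono-< f≤g {xs = _ ∷ xs} (here refl) fy<gy = +-mono-<-≤ fy<gy (sumL-mono f≤g xs)
  sumL-mono-< f≤g {xs = x ∷ _} (there y∈xs) fy<gy = +-mono-≤-< (f≤g x) (sumL-mono-< f≤g y∈xs fy<gy)

injection⇒≤count : ∀ {N k} (P : Fin N → Bool) (u : Fin k → Fin N) →
  Injective _≡_ _≡_ u → (∀ i → P (u i) ≡ true) → k ≤ count P (allFin N)
injection⇒≤count {k = zero} _ _ _ _ = z≤n
injection⇒≤count {N} {suc k} P u inj Pu = begin
  1 + k
    ≤⟨ +-mono-≤ (count-positive (∈-allFin u₀) P₀u₀)
                (injection⇒≤count P₁ (u ∘ F.suc) (suc-injective ∘ inj) P₁u) ⟩
  count P₀ (allFin N) + count P₁ (allFin N)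
    ≡⟨ ≡-sym (count-split P (λ y → ⌊ u₀ ≟ y ⌋) (allFin N)) ⟩
  count P (allFin N) ∎
  where
  open ≤-Reasoning
  u₀ : Fin N
  u₀ = u F.zero
  P₀ P₁ : Fin N → Bool
  P₀ y = P y ∧ ⌊ u₀ ≟ y ⌋
  P₁ y = P y ∧ not ⌊ u₀ ≟ y ⌋
  P₀u₀ : P₀ u₀ ≡ true
  P₀u₀ = cong₂ _∧_ (Pu F.zero) (⌊⌋-yes (u₀ ≟ u₀) refl)
  P₁u : ∀ i → P₁ (u (F.suc i)) ≡ true
  P₁u i = cong₂ _∧_ (Pu (F.suc i)) (cong not (⌊⌋-no (u₀ ≟ u (F.suc i)) (0≢1+n ∘ inj)))

free-colour : ∀ {N d} (c : Fin N → Fin (suc d)) (Q : Fin N → Bool) →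
  count Q (allFin N) ≤ d → ∃ λ col → ∀ y → Q y ≡ true → c y ≢ col
free-colour {N} {d} c Q few =
  let col , unused = ¬∀⟶∃¬ (suc d) Used used? not-all-used
  in  col , λ y Qy cy≡col → unused (y , Qy , cy≡col)
  where
  Used : Fin (suc d) → Set
  Used j = ∃ λ y → Q y ≡ true × c y ≡ j
  used? : Decidable Used
  used? j = any? λ y → (Q y ≟𝔹 true) ×-dec (c y ≟ j)
  not-all-used : ¬ (∀ j → Used j)
  not-all-used all-used =
    n≮n d (≤-trans (injection⇒≤count Q witness witness-injective (proj₁ ∘ proj₂ ∘ all-used)) few)
    where
    witness : Fin (suc d) → Fin N
    witness = proj₁ ∘ all-used
    witness-injective : Injective _≡_ _≡_ witness
    witness-injective {i} {j} eq =
      trans (≡-sym (proj₂ (proj₂ (all-used i)))) (trans (cong c eq) (proj₂ (proj₂ (all-used j))))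

descending : ∀ {A : Set} {k} → (Fin k → A) → List A
descending {k = zero}  u = []
descending {k = suc k} u = u (fromℕ k) ∷ descending (u ∘ inject₁)

∈-descending : ∀ {A : Set} {k} (u : Fin k → A) i → u i ∈ descending u
∈-descending {k = suc k} u i with k ≟ℕ toℕ i
... | yes k≡i = here (cong u (toℕ-injective (trans (≡-sym k≡i) (≡-sym (toℕ-fromℕ k)))))
... | no  k≢i = there (subst (_∈ descending (u ∘ inject₁)) (cong u (inject₁-lower₁ i k≢i))
                              (∈-descending (u ∘ inject₁) (lower₁ i k≢i)))

≟-sym : ∀ {m} (a b : Fin m) → ⌊ a ≟ b ⌋ ≡ ⌊ b ≟ a ⌋
≟-sym a b with a ≟ b
... | yes a≡b = ≡-sym (⌊⌋-yes (b ≟ a) (≡-sym a≡b))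
... | no  a≢b = ≡-sym (⌊⌋-no (b ≟ a) (a≢b ∘ ≡-sym))

module _ (G : Graph) where

  private
    N : ℕ
    N = n G

  adj⇒≢ : ∀ {a b} → adj G a b ≡ true → a ≢ b
  adj⇒≢ {a} ab refl = contradiction (trans (≡-sym ab) (irrefl G a)) λ ()

  near-sym : ∀ a b → near G a b ≡ near G b a
  near-sym a b = cong₂ _∧_ (cong not (≟-sym a b)) (cong₂ _∨_ (sym G a b) (cong or (map-cong
    (λ x → trans (cong₂ _∧_ (sym G a x) (sym G x b)) (∧-comm (adj G x a) (adj G b x))) (V G))))

  near-irrefl : ∀ a → near G a a ≡ false
  near-irrefl a =
    cong (λ b → not b ∧ (adj G a a ∨ any (λ x → adj G a x ∧ adj G x a) (V G))) (⌊⌋-yes (a ≟ a) refl)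

  adj⇒near : ∀ {a b} → adj G a b ≡ true → near G a b ≡ true
  adj⇒near {a} {b} ab = cong₂ _∧_ (cong not (⌊⌋-no (a ≟ b) (adj⇒≢ ab)))
    (cong (_∨ any (λ x → adj G a x ∧ adj G x b) (V G)) ab)

  adj-adj⇒near : ∀ {a b} z → a ≢ b → adj G a z ≡ true → adj G z b ≡ true → near G a b ≡ true
  adj-adj⇒near {a} {b} z a≢b az zb = cong₂ _∧_ (cong not (⌊⌋-no (a ≟ b) a≢b))
    (trans (cong (adj G a b ∨_) (any-true (λ x → adj G a x ∧ adj G x b) (∈-allFin z) (cong₂ _∧_ az zb)))
           (∨-zeroʳ (adj G a b)))

  open import Data.List.Membership.DecPropositional (_≟_ {N}) using (_∈?_)

  ProperExcept : ∀ {k} → List (Fin N) → (Fin N → Fin k) → Set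
  ProperExcept L c = ∀ a b → near G a b ≡ true → a ∉ L → b ∉ L → c a ≢ c b

  colouredNear : List (Fin N) → Fin N → ℕ
  colouredNear L x = count (λ y → near G x y ∧ not ⌊ y ∈? L ⌋) (V G)

  recolour : ∀ {k} → (Fin N → Fin k) → Fin N → Fin k → Fin N → Fin k
  recolour c x col y with x ≟ y
  ... | yes _ = col
  ... | no  _ = c y

  extend : ∀ {d x L} (c : Fin N → Fin (suc d)) → ProperExcept (x ∷ L) c →
    colouredNear (x ∷ L) x ≤ d → ∃ λ c′ → ProperExcept L c′
  extend {d} {x} {L} c proper few =
    let col , col-free = free-colour c coloured few
    in  recolour c x col , recoloured-proper col col-free
    where
    coloured : Fin N → Bool
    coloured y = near G x y ∧ not ⌊ y ∈? x ∷ L ⌋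
    ∉-∷ : ∀ {y} → x ≢ y → y ∉ L → y ∉ x ∷ L
    ∉-∷ x≢y y∉L (here y≡x) = x≢y (≡-sym y≡x)
    ∉-∷ x≢y y∉L (there y∈L) = y∉L y∈L
    coloured-near : ∀ {y} → near G x y ≡ true → x ≢ y → y ∉ L → coloured y ≡ true
    coloured-near {y} xy x≢y y∉L = cong₂ _∧_ xy (cong not (⌊⌋-no (y ∈? x ∷ L) (∉-∷ x≢y y∉L)))
    recoloured-proper : ∀ col → (∀ y → coloured y ≡ true → c y ≢ col) →
                        ProperExcept L (recolour c x col)
    recoloured-proper col col-free a b ab a∉L b∉L with x ≟ a | x ≟ b
    ... | yes refl | yes refl = contradiction (trans (≡-sym ab) (near-irrefl a)) λ ()
    ... | yes refl | no  x≢b  = col-free b (coloured-near ab x≢b b∉L) ∘ ≡-sym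
    ... | no  x≢a  | yes refl = col-free a (coloured-near (trans (near-sym x a) ab) x≢a a∉L)
    ... | no  x≢a  | no  x≢b  = proper a b ab (∉-∷ x≢a a∉L) (∉-∷ x≢b b∉L)

  data GreedyOrder (d : ℕ) : List (Fin N) → Set where
    []  : GreedyOrder d []
    _∷_ : ∀ {x L} → colouredNear (x ∷ L) x ≤ d → GreedyOrder d L → GreedyOrder d (x ∷ L)

  greedy-colouring : ∀ {d L} {c : Fin N → Fin (suc d)} →
    GreedyOrder d L → ProperExcept L c → TwoDistColoring G (suc d)
  greedy-colouring {c = c} [] proper = c , λ a b ab → proper a b ab (λ ()) (λ ())
  greedy-colouring {c = c} (few ∷ order) proper =
    greedy-colouring order (proj₂ (extend c proper few))

  colouredNear-≤ : ∀ {d m} L x (e : Fin m → Fin N) → Injective _≡_ _≡_ e →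
    (∀ j → near G x (e j) ≡ true) → (∀ j → e j ∈ L) → dstar G x ≤ d + m → colouredNear L x ≤ d
  colouredNear-≤ {d} {m} L x e e-inj x∼∼e e∈L d*x = +-cancelˡ-≤ m _ _ (begin
    m + colouredNear L x
      ≤⟨ +-monoˡ-≤ (colouredNear L x) (injection⇒≤count _ e e-inj
           (λ j → cong₂ _∧_ (x∼∼e j) (⌊⌋-yes (e j ∈? L) (e∈L j)))) ⟩
    count (λ y → near G x y ∧ ⌊ y ∈? L ⌋) (V G) + colouredNear L x
      ≡⟨ ≡-sym (count-split (near G x) (λ y → ⌊ y ∈? L ⌋) (V G)) ⟩
    dstar G x  ≤⟨ d*x ⟩
    d + m      ≡⟨ +-comm d m ⟩
    m + d      ∎)
    where open ≤-Reasoning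

  descending-greedy : ∀ {d k} w (u : Fin k → Fin N) → Injective _≡_ _≡_ u →
    (∀ i → adj G w (u i) ≡ true) → (∀ i → dstar G (u i) ≤ d + toℕ i) →
    GreedyOrder d (descending u)
  descending-greedy {k = zero}  w u _ _ _ = []
  descending-greedy {d} {suc k} w u u-inj w∼u d*u =
    colouredNear-≤ _ x (u ∘ inject₁) (inject₁-injective ∘ u-inj) x∼∼u
      (there ∘ ∈-descending (u ∘ inject₁))
      (subst (λ t → dstar G x ≤ d + t) (toℕ-fromℕ k) (d*u (fromℕ k)))
    ∷ descending-greedy w (u ∘ inject₁) (inject₁-injective ∘ u-inj) (w∼u ∘ inject₁)
        (λ i → subst (λ t → dstar G (u (inject₁ i)) ≤ d + t) (toℕ-inject₁ i) (d*u (inject₁ i)))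
    where
    x : Fin N
    x = u (fromℕ k)
    x∼∼u : ∀ j → near G x (u (inject₁ j)) ≡ true
    x∼∼u j =
      adj-adj⇒near w (fromℕ≢inject₁ ∘ u-inj) (trans (sym G x w) (w∼u (fromℕ k))) (w∼u (inject₁ j))

  star-greedy : ∀ {d k} w (u : Fin k → Fin N) → Injective _≡_ _≡_ u →
    (∀ i → adj G w (u i) ≡ true) → (∀ i → dstar G (u i) ≤ d + toℕ i) →
    dstar G w ≤ d + k → GreedyOrder d (w ∷ descending u)
  star-greedy w u u-inj w∼u d*u d*w =
    colouredNear-≤ _ w u u-inj (adj⇒near ∘ w∼u) (there ∘ ∈-descending u) d*w
    ∷ descending-greedy w u u-inj w∼u d*u

module _ (G : Graph) (a b : Fin (n G)) where

  private
    N : ℕ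
    N = n G

    touches : Fin N → Bool
    touches p = ⌊ p ≟ a ⌋ ∨ ⌊ p ≟ b ⌋

  -- The only edge with both ends in {a, b} is ab; phrased this way, symmetry is immediate.
  deleteEdge : Graph
  deleteEdge = record
    { n      = N
    ; adj    = λ p q → adj G p q ∧ not (touches p ∧ touches q)
    ; sym    = λ p q → cong₂ _∧_ (sym G p q) (cong not (∧-comm (touches p) (touches q)))
    ; irrefl = λ p → cong (_∧ not (touches p ∧ touches p)) (irrefl G p)
    }

  deleteEdge-⊆ : ∀ {p q} → adj deleteEdge p q ≡ true → adj G p q ≡ true
  deleteEdge-⊆ = ∧-conicalˡ _ _

  deleteEdge-mad : MadLe18/7 G → MadLe18/7 deleteEdge
  deleteEdge-mad mad A = ≤-trans (*-monoʳ-≤ 7 fewer-edges) (mad A)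
    where
    fewer-edges : eIn deleteEdge A ≤ eIn G A
    fewer-edges = sumL-mono (λ p → count-mono (λ q →
      ∧-monoʳ (toℕ p <ᵇ toℕ q) (∧-monoʳ (lookup A p) (∧-monoʳ (lookup A q) deleteEdge-⊆))) (V G)) (V G)

  deleteEdge-maxDeg : ∀ {D} → MaxDeg≤ G D → MaxDeg≤ deleteEdge D
  deleteEdge-maxDeg maxDeg v = ≤-trans (count-mono (λ _ → deleteEdge-⊆) (V G)) (maxDeg v)

  private
    touches-a : touches a ≡ true
    touches-a = cong (_∨ ⌊ a ≟ b ⌋) (⌊⌋-yes (a ≟ a) refl)

    touches-b : touches b ≡ true
    touches-b = trans (cong (⌊ b ≟ a ⌋ ∨_) (⌊⌋-yes (b ≟ b) refl)) (∨-zeroʳ ⌊ b ≟ a ⌋)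

    removed : ∀ {p q} → touches p ≡ true → touches q ≡ true → adj deleteEdge p q ≡ false
    removed {p} {q} tp tq =
      trans (cong (λ t → adj G p q ∧ not t) (cong₂ _∧_ tp tq)) (∧-zeroʳ (adj G p q))

    edges-< : ∀ {r s} → toℕ r < toℕ s → adj deleteEdge r s ≡ false → adj G r s ≡ true →
              edges deleteEdge < edges G
    edges-< {r} {s} r<s r≁s r∼s =
      sumL-mono-< (λ p → count-mono (λ q → ∧-monoʳ (toℕ p <ᵇ toℕ q) deleteEdge-⊆) (V G)) (∈-allFin r)
        (count-mono-< (λ q → ∧-monoʳ (toℕ r <ᵇ toℕ q) deleteEdge-⊆) (∈-allFin s)
          (trans (cong ((toℕ r <ᵇ toℕ s) ∧_) r≁s) (∧-zeroʳ (toℕ r <ᵇ toℕ s)))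
          (cong₂ _∧_ (to T-≡ (<⇒<ᵇ r<s)) r∼s))

    near-unchanged : ∀ {x y} → touches x ≡ false → touches y ≡ false →
                     near deleteEdge x y ≡ near G x y
    near-unchanged {x} {y} tx ty = cong (not ⌊ x ≟ y ⌋ ∧_)
      (cong₂ _∨_ (from-x y) (cong or (map-cong (λ z → cong₂ _∧_ (from-x z) (to-y z)) (V G))))
      where
      from-x : ∀ z → adj deleteEdge x z ≡ adj G x z
      from-x z = trans (cong (λ t → adj G x z ∧ not (t ∧ touches z)) tx) (∧-identityʳ (adj G x z))
      to-y : ∀ z → adj deleteEdge z y ≡ adj G z y
      to-y z = trans (cong (λ t → adj G z y ∧ not t)
                           (trans (cong (touches z ∧_) ty) (∧-zeroʳ (touches z))))
                     (∧-identityʳ (adj G z y))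

  deleteEdge-edges-< : adj G a b ≡ true → edges deleteEdge < edges G
  deleteEdge-edges-< ab with <-cmp (toℕ a) (toℕ b)
  ... | tri< a<b _ _ = edges-< a<b (removed touches-a touches-b) ab
  ... | tri≈ _ a≡b _ = contradiction (toℕ-injective a≡b) (adj⇒≢ G ab)
  ... | tri> _ _ b<a = edges-< b<a (removed touches-b touches-a) (trans (sym G b a) ab)

  deleteEdge-properExcept : ∀ {k L} → a ∈ L → b ∈ L →
    (col : TwoDistColoring deleteEdge k) → ProperExcept G L (proj₁ col)
  deleteEdge-properExcept {L = L} a∈L b∈L (c , proper) x y xy x∉L y∉L =
    proper x y (trans (near-unchanged (untouched x∉L) (untouched y∉L)) xy)
    where
    untouched : ∀ {z} → z ∉ L → touches z ≡ false
    untouched {z} z∉L =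
      cong₂ _∨_ (⌊⌋-no (z ≟ a) λ { refl → z∉L a∈L }) (⌊⌋-no (z ≟ b) λ { refl → z∉L b∈L })

lemma5 : (G : Graph) → MinimalCounterexample G →
    (w : Fin (n G)) (k : ℕ) → 1 ≤ k → k ≤ deg G w →
    (u : Fin k → Fin (n G)) → Injective _≡_ _≡_ u →
    (∀ i → adj G w (u i) ≡ true) →
    (∀ i → dstar G (u i) ≤ 7 + toℕ i) →
    dstar G w ≥ 7 + k + 1
lemma5 G (mad , (maxDeg , _) , uncolourable , minimal) w (suc k) _ _ u u-inj w∼u d*u
  with dstar G w ≤? 7 + suc k
... | no  d*w≰ = subst (_≤ dstar G w) (+-comm 1 (7 + suc k)) (≰⇒> d*w≰)
... | yes d*w≤ = ⊥-elim (uncolourable (greedy-colouring G order proper))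
  where
  u₀ : Fin (n G)
  u₀ = u F.zero
  G⁻ : Graph
  G⁻ = deleteEdge G w u₀
  colouring : TwoDistColoring G⁻ 8
  colouring = minimal G⁻ (deleteEdge-mad G w u₀ mad) (deleteEdge-maxDeg G w u₀ maxDeg)
                (+-monoʳ-< (n G) (deleteEdge-edges-< G w u₀ (w∼u F.zero)))
  proper : ProperExcept G (w ∷ descending u) (proj₁ colouring)
  proper = deleteEdge-properExcept G w u₀ (here refl) (there (∈-descending u F.zero)) colouring
  order : GreedyOrder G 7 (w ∷ descending u)
  order = star-greedy G w u u-inj w∼u d*u d*w≤
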